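{- Let $\mathcal{A}=\left(\frac{ -a,-b}{\mathbb{Q}}\right)$ be a rational quaternion division algebra with $a,b>0$, and let $H$ be an order in $\mathcal{A}$ with $\mathbb{Z}$-basis $\{1,v_1,v_2,v_3\}$, where $v_r=a_{r,0}+a_{r,1}i+a_{r,2}j+a_{r,3}k$ for $r=1,2,3$. Let $d=(1+a)(1+b)$, $M=\max_{1\le r\le3,\,0\le s\le3}|a_{r,s}|$, and $Q=\lceil 2M(1+\sqrt{1+3d})\rceil$. Let $p$ be a prime and $\delta=d_0+d_1v_1+d_2v_2+d_3v_3$ with $d_i\in\mathbb{Z}$ and $|d_i|\le\frac{p}{2}$ for all $i$. If $|d_i|<\frac{p}{Q}$ for $i=1,2,3$, then $\mathrm{N}\left(\frac{\delta}{p}\right)<1$.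
   Context: $\mathcal{A}$ has $\mathbb{Q}$-basis $1,i,j,k$ with $i^2=-a$, $j^2=-b$, $k=ij=-ji$, and norm $\mathrm{N}(x_0+x_1i+x_2j+x_3k)=x_0^2+ax_1^2+bx_2^2+abx_3^2$. An order is a subring containing $1$ that is a finitely generated $\mathbb{Z}$-module spanning $\mathcal{A}$ over $\mathbb{Q}$. -}

module Defs where

open import Data.Integer using (ℤ)
open import Data.Nat using (ℕ)
open import Data.Nat.Primality using (Prime; prime⇒nonZero)
open import Data.Rational using (ℚ; 0ℚ; 1ℚ; _+_; _*_; _-_; -_; ∣_∣; _⊔_; _≤_; _<_; _/_)
open import Data.Product using (_×_; Σ; ∃)
open import Data.Sum using (_⊎_)
open import Relation.Binary.PropositionalEquality using (_≡_; _≢_)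
import Data.Integer as ℤ

-- Elements of the quaternion algebra (-a,-b / ℚ): x0 + x1 i + x2 j + x3 k.
record Quat : Set where
  constructor quat
  field
    q0 q1 q2 q3 : ℚ
open Quat public

ofℚ : ℚ → Quat
ofℚ x = quat x 0ℚ 0ℚ 0ℚ

ofℤ : ℤ → ℚ
ofℤ n = n / 1

0H 1H : Quat
0H = ofℚ 0ℚ
1H = ofℚ 1ℚ

_+H_ : Quat → Quat → Quat
quat x0 x1 x2 x3 +H quat y0 y1 y2 y3 = quat (x0 + y0) (x1 + y1) (x2 + y2) (x3 + y3)

_·H_ : ℚ → Quat → Quat
c ·H quat x0 x1 x2 x3 = quat (c * x0) (c * x1) (c * x2) (c * x3)

-- Multiplication in (-a,-b / ℚ): i² = -a, j² = -b, k = ij = -ji.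
-- (Hence k² = -ab, jk = b i, kj = -b i, ki = a j, ik = -a j.)
mulH : (a b : ℚ) → Quat → Quat → Quat
mulH a b (quat x0 x1 x2 x3) (quat y0 y1 y2 y3) =
  quat (x0 * y0 - a * (x1 * y1) - b * (x2 * y2) - (a * b) * (x3 * y3))
       (x0 * y1 + x1 * y0 + b * (x2 * y3 - x3 * y2))
       (x0 * y2 + x2 * y0 + a * (x3 * y1 - x1 * y3))
       (x0 * y3 + x3 * y0 + x1 * y2 - x2 * y1)

normH : (a b : ℚ) → Quat → ℚ
normH a b (quat x0 x1 x2 x3) =
  x0 * x0 + a * (x1 * x1) + b * (x2 * x2) + (a * b) * (x3 * x3)

IsDivisionAlgebra : ℚ → ℚ → Set
IsDivisionAlgebra a b =
  ∀ (x : Quat) → x ≢ 0H → Σ Quat λ y → (mulH a b x y ≡ 1H) × (mulH a b y x ≡ 1H)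

zcomb : ℤ → ℤ → ℤ → ℤ → Quat → Quat → Quat → Quat
zcomb n0 n1 n2 n3 v1 v2 v3 =
  ofℚ (ofℤ n0) +H ((ofℤ n1 ·H v1) +H ((ofℤ n2 ·H v2) +H (ofℤ n3 ·H v3)))

InZSpan : Quat → Quat → Quat → Quat → Set
InZSpan v1 v2 v3 x = ∃ λ n0 → ∃ λ n1 → ∃ λ n2 → ∃ λ n3 → zcomb n0 n1 n2 n3 v1 v2 v3 ≡ x

QLinIndep : Quat → Quat → Quat → Set
QLinIndep v1 v2 v3 = ∀ (c0 c1 c2 c3 : ℚ) →
  ofℚ c0 +H ((c1 ·H v1) +H ((c2 ·H v2) +H (c3 ·H v3))) ≡ 0H →
  (c0 ≡ 0ℚ) × (c1 ≡ 0ℚ) × (c2 ≡ 0ℚ) × (c3 ≡ 0ℚ)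

-- H = ℤ1 + ℤv1 + ℤv2 + ℤv3 is an order of (-a,-b/ℚ) with ℤ-basis {1,v1,v2,v3}:
-- the ℤ-span is closed under multiplication (it contains 1 and is a finitely
-- generated ℤ-module, so it is then a subring), and {1,v1,v2,v3} is a ℚ-basis of
-- the algebra (so it spans it over ℚ and is a ℤ-basis of H).
IsOrderWithBasis : ℚ → ℚ → Quat → Quat → Quat → Set
IsOrderWithBasis a b v1 v2 v3 =
  QLinIndep v1 v2 v3 ×
  (∀ x y → InZSpan v1 v2 v3 x → InZSpan v1 v2 v3 y → InZSpan v1 v2 v3 (mulH a b x y))

maxAbs : Quat → ℚ
maxAbs (quat x0 x1 x2 x3) = ∣ x0 ∣ ⊔ ∣ x1 ∣ ⊔ ∣ x2 ∣ ⊔ ∣ x3 ∣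

maxCoeff : Quat → Quat → Quat → ℚ
maxCoeff v1 v2 v3 = maxAbs v1 ⊔ maxAbs v2 ⊔ maxAbs v3

-- Real numbers of the form r + c·√D with r, c, D rational, c ≥ 0, D ≥ 0,
-- represented by (r, c, D); comparison with rationals done exactly by squaring.
-- r + c√D ≤ q   ⇔   c√D ≤ q - r   ⇔   q - r ≥ 0  and  c²D ≤ (q - r)²
SqrtLe : (r c D q : ℚ) → Set
SqrtLe r c D q = (0ℚ ≤ q - r) × (c * c * D ≤ (q - r) * (q - r))

-- q < r + c√D   ⇔   q - r < c√D   ⇔   q - r < 0  or  (q - r)² < c²D
SqrtGt : (r c D q : ℚ) → Set
SqrtGt r c D q = (q - r < 0ℚ) ⊎ ((q - r) * (q - r) < c * c * D)

-- Q = ⌈ r + c√D ⌉  (Q integer with r + c√D ≤ Q < r + c√D + 1)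
IsCeilSqrt : (r c D : ℚ) → ℤ → Set
IsCeilSqrt r c D Q = SqrtLe r c D (ofℤ Q) × SqrtGt r c D (ofℤ Q - 1ℚ)

-- Q = ⌈ 2M(1 + √(1 + 3d)) ⌉ with d = (1+a)(1+b)
IsQ : (a b M : ℚ) → ℤ → Set
IsQ a b M Q = IsCeilSqrt (ofℤ (ℤ.+ 2) * M) (ofℤ (ℤ.+ 2) * M)
                         (1ℚ + ofℤ (ℤ.+ 3) * ((1ℚ + a) * (1ℚ + b))) Q

invPrime : (p : ℕ) → Prime p → ℚ
invPrime p pp = (ℤ.+ 1) / p
  where instance _ = prime⇒nonZero pp

{-# OPTIONS --safe #-}
-- Write e = max(|d₁|,|d₂|,|d₃|) and t = 3Me. Every coordinate of δ = d₀ + Σ dᵣvᵣ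
-- other than the first is at most t in absolute value, the first at most p/2 + t, so
-- N(δ) ≤ (p/2 + t)² + (a + b + ab)t². With u = 2Me this bound equals
-- p² − ¾((p − u)² − (1 + 3d)u²), and (p − u)² > (1 + 3d)u² says 2Me(1 + √(1 + 3d)) < p,
-- which follows from eQ < p and the choice of Q. Hence N(δ/p) = N(δ)/p² < 1.
module Submission where

open import Defs
open import Data.Nat using (ℕ; suc)
import Data.Nat as ℕ
import Data.Nat.Properties as ℕₚ
open import Data.Nat.Primality using (Prime; prime⇒nonZero)
open import Data.Integer using (ℤ; +_)
import Data.Integer as ℤ
import Data.Integer.Properties as ℤₚ
open import Data.Rational
open import Data.Rational.Properties
import Data.Rational.Unnormalised as ℚᵘ
import Data.Rational.Unnormalised.Properties as ℚᵘₚ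
open import Data.Rational.Solver using (module +-*-Solver)
open +-*-Solver
open import Data.Product using (_,_)
open import Data.Sum using (inj₁; inj₂)
open import Data.Empty using (⊥-elim)
open import Relation.Binary.PropositionalEquality
  using (_≡_; refl; sym; trans; cong; cong₂; subst; subst₂; module ≡-Reasoning)

toℚᵘ-/ : ∀ i m → toℚᵘ (i / suc m) ℚᵘ.≃ ℚᵘ.mkℚᵘ i m
toℚᵘ-/ i m = toℚᵘ-fromℚᵘ (ℚᵘ.mkℚᵘ i m)

*-/ : ∀ i j m n → (i / suc m) * (j / suc n) ≡ (i ℤ.* j) / (suc m ℕ.* suc n)
*-/ i j m n = toℚᵘ-injective (begin
  toℚᵘ ((i / suc m) * (j / suc n))         ≈⟨ toℚᵘ-homo-* (i / suc m) (j / suc n) ⟩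
  toℚᵘ (i / suc m) ℚᵘ.* toℚᵘ (j / suc n)   ≈⟨ ℚᵘₚ.*-cong (toℚᵘ-/ i m) (toℚᵘ-/ j n) ⟩
  ℚᵘ.mkℚᵘ i m ℚᵘ.* ℚᵘ.mkℚᵘ j n             ≈⟨ ℚᵘₚ.≃-sym (toℚᵘ-/ (i ℤ.* j) _) ⟩
  toℚᵘ ((i ℤ.* j) / (suc m ℕ.* suc n))     ∎)
  where open ℚᵘₚ.≃-Reasoning

n/n≡1 : ∀ m → + suc m / suc m ≡ 1ℚ
n/n≡1 m = toℚᵘ-injective (ℚᵘₚ.≃-trans (toℚᵘ-/ (+ suc m) m) (ℚᵘ.*≡* (ℤₚ.*-comm (+ suc m) (+ 1))))

1/n*n≡1 : ∀ m → (+ 1 / suc m) * (+ suc m / 1) ≡ 1ℚ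
1/n*n≡1 m = begin
  (+ 1 / suc m) * (+ suc m / 1)       ≡⟨ *-/ (+ 1) (+ suc m) m 0 ⟩
  (+ 1 ℤ.* + suc m) / (suc m ℕ.* 1)   ≡⟨ /-cong (ℤₚ.*-identityˡ (+ suc m)) (ℕₚ.*-identityʳ (suc m)) ⟩
  + suc m / suc m                     ≡⟨ n/n≡1 m ⟩
  1ℚ                                  ∎
  where open ≡-Reasoning

n/2≡½*n : ∀ n → + n / 2 ≡ ½ * (+ n / 1)
n/2≡½*n n = sym (trans (*-/ (+ 1) (+ n) 1 0) (cong (_/ 2) (ℤₚ.*-identityˡ (+ n))))

⊔-preserves : ∀ (P : ℚ → Set) p q → P p → P q → P (p ⊔ q)
⊔-preserves P p q Pp Pq with ⊔-sel p q
... | inj₁ p⊔q≡p rewrite p⊔q≡p = Pp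
... | inj₂ p⊔q≡q rewrite p⊔q≡q = Pq

p≤p⊔q⊔r : ∀ p q r → p ≤ p ⊔ q ⊔ r
p≤p⊔q⊔r p q r = ≤-trans (p≤p⊔q p q) (p≤p⊔q (p ⊔ q) r)

q≤p⊔q⊔r : ∀ p q r → q ≤ p ⊔ q ⊔ r
q≤p⊔q⊔r p q r = ≤-trans (p≤q⊔p p q) (p≤p⊔q (p ⊔ q) r)

r≤p⊔q⊔r : ∀ p q r → r ≤ p ⊔ q ⊔ r
r≤p⊔q⊔r p q r = p≤q⊔p (p ⊔ q) r

p<q⇒0<q-p : ∀ {p q} → p < q → 0ℚ < q - p
p<q⇒0<q-p {p} {q} p<q = subst (_< q - p) (+-inverseʳ p) (+-monoˡ-< (- p) p<q)

*-self-mono-≤ : ∀ {p q} → 0ℚ ≤ p → p ≤ q → p * p ≤ q * q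
*-self-mono-≤ {p} {q} 0≤p p≤q =
  ≤-trans (*-monoˡ-≤-nonNeg p {{nonNegative 0≤p}} p≤q)
          (*-monoʳ-≤-nonNeg q {{nonNegative (≤-trans 0≤p p≤q)}} p≤q)

*-self-mono-< : ∀ {p q} → 0ℚ ≤ p → p < q → p * p < q * q
*-self-mono-< {p} {q} 0≤p p<q =
  ≤-<-trans (*-monoˡ-≤-nonNeg p {{nonNegative 0≤p}} (<⇒≤ p<q))
            (*-monoˡ-<-pos q {{positive (≤-<-trans 0≤p p<q)}} p<q)

∣p∣*∣p∣≡p*p : ∀ p → ∣ p ∣ * ∣ p ∣ ≡ p * p
∣p∣*∣p∣≡p*p p with ∣p∣≡p∨∣p∣≡-p p
... | inj₁ ∣p∣≡p  rewrite ∣p∣≡p  = refl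
... | inj₂ ∣p∣≡-p rewrite ∣p∣≡-p = solve 1 (λ p → (:- p) :* (:- p) := p :* p) refl p

∣p∣≤q⇒p*p≤q*q : ∀ {p q} → ∣ p ∣ ≤ q → p * p ≤ q * q
∣p∣≤q⇒p*p≤q*q {p} ∣p∣≤q = subst (_≤ _) (∣p∣*∣p∣≡p*p p) (*-self-mono-≤ (0≤∣p∣ p) ∣p∣≤q)

∣p*q∣≤r*s : ∀ {p q r s} → ∣ p ∣ ≤ r → ∣ q ∣ ≤ s → ∣ p * q ∣ ≤ r * s
∣p*q∣≤r*s {p} {q} {r} {s} ∣p∣≤r ∣q∣≤s = begin
  ∣ p * q ∣      ≡⟨ ∣p*q∣≡∣p∣*∣q∣ p q ⟩
  ∣ p ∣ * ∣ q ∣  ≤⟨ *-monoʳ-≤-nonNeg ∣ q ∣ {{∣-∣-nonNeg q}} ∣p∣≤r ⟩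
  r * ∣ q ∣      ≤⟨ *-monoˡ-≤-nonNeg r {{nonNegative (≤-trans (0≤∣p∣ p) ∣p∣≤r)}} ∣q∣≤s ⟩
  r * s          ∎
  where open ≤-Reasoning

SqrtLe-scale : ∀ {r c D q} e → 0ℚ ≤ e → SqrtLe r c D q → SqrtLe (e * r) (e * c) D (e * q)
SqrtLe-scale {r} {c} {D} {q} e 0≤e (0≤q-r , c²D≤[q-r]²) = 0≤e[q-r] , e²c²D≤e²[q-r]²
  where
  0≤e[q-r] : 0ℚ ≤ e * q - e * r
  0≤e[q-r] = subst (0ℚ ≤_) (solve 3 (λ e q r → e :* (q :- r) := e :* q :- e :* r) refl e q r)
    (nonNegative⁻¹ _ {{nonNeg*nonNeg⇒nonNeg e {{nonNegative 0≤e}} (q - r) {{nonNegative 0≤q-r}}}})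
  e²c²D≤e²[q-r]² : e * c * (e * c) * D ≤ (e * q - e * r) * (e * q - e * r)
  e²c²D≤e²[q-r]² = subst₂ _≤_
    (solve 3 (λ e c D → e :* e :* (c :* c :* D) := e :* c :* (e :* c) :* D) refl e c D)
    (solve 3 (λ e q r → e :* e :* ((q :- r) :* (q :- r)) := (e :* q :- e :* r) :* (e :* q :- e :* r)) refl e q r)
    (*-monoˡ-≤-nonNeg (e * e) {{nonNeg*nonNeg⇒nonNeg e {{nonNegative 0≤e}} e {{nonNegative 0≤e}}}} c²D≤[q-r]²)

SqrtLe-<⇒ : ∀ {r c D q P} → SqrtLe r c D q → q < P → c * c * D < (P - r) * (P - r)
SqrtLe-<⇒ {r} (0≤q-r , c²D≤[q-r]²) q<P =
  ≤-<-trans c²D≤[q-r]² (*-self-mono-< 0≤q-r (+-monoˡ-< (- r) q<P))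

∣q0∣≤maxAbs : ∀ x → ∣ q0 x ∣ ≤ maxAbs x
∣q0∣≤maxAbs x = ≤-trans (p≤p⊔q⊔r (∣ q0 x ∣) (∣ q1 x ∣) (∣ q2 x ∣)) (p≤p⊔q _ ∣ q3 x ∣)

∣q1∣≤maxAbs : ∀ x → ∣ q1 x ∣ ≤ maxAbs x
∣q1∣≤maxAbs x = ≤-trans (q≤p⊔q⊔r (∣ q0 x ∣) (∣ q1 x ∣) (∣ q2 x ∣)) (p≤p⊔q _ ∣ q3 x ∣)

∣q2∣≤maxAbs : ∀ x → ∣ q2 x ∣ ≤ maxAbs x
∣q2∣≤maxAbs x = ≤-trans (r≤p⊔q⊔r (∣ q0 x ∣) (∣ q1 x ∣) (∣ q2 x ∣)) (p≤p⊔q _ ∣ q3 x ∣)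

∣q3∣≤maxAbs : ∀ x → ∣ q3 x ∣ ≤ maxAbs x
∣q3∣≤maxAbs x = p≤q⊔p (∣ q0 x ∣ ⊔ ∣ q1 x ∣ ⊔ ∣ q2 x ∣) ∣ q3 x ∣

∣Σdᵣπvᵣ∣≤3*maxCoeff*max∣dᵣ∣ : ∀ (π : Quat → ℚ) → (∀ x → ∣ π x ∣ ≤ maxAbs x) → ∀ d1 d2 d3 v1 v2 v3 →
  ∣ d1 * π v1 + (d2 * π v2 + d3 * π v3) ∣ ≤ ofℤ (+ 3) * maxCoeff v1 v2 v3 * (∣ d1 ∣ ⊔ ∣ d2 ∣ ⊔ ∣ d3 ∣)
∣Σdᵣπvᵣ∣≤3*maxCoeff*max∣dᵣ∣ π ∣π∣≤maxAbs d1 d2 d3 v1 v2 v3 = begin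
  ∣ d1 * π v1 + (d2 * π v2 + d3 * π v3) ∣          ≤⟨ ∣p+q∣≤∣p∣+∣q∣ (d1 * π v1) _ ⟩
  ∣ d1 * π v1 ∣ + ∣ d2 * π v2 + d3 * π v3 ∣        ≤⟨ +-monoʳ-≤ ∣ d1 * π v1 ∣ (∣p+q∣≤∣p∣+∣q∣ (d2 * π v2) _) ⟩
  ∣ d1 * π v1 ∣ + (∣ d2 * π v2 ∣ + ∣ d3 * π v3 ∣)  ≤⟨ +-mono-≤ (term (p≤p⊔q⊔r ∣d1∣ ∣d2∣ ∣d3∣) (p≤p⊔q⊔r M1 M2 M3))
                                                       (+-mono-≤ (term (q≤p⊔q⊔r ∣d1∣ ∣d2∣ ∣d3∣) (q≤p⊔q⊔r M1 M2 M3))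
                                                                 (term (r≤p⊔q⊔r ∣d1∣ ∣d2∣ ∣d3∣) (r≤p⊔q⊔r M1 M2 M3))) ⟩
  e * M + (e * M + e * M)                          ≡⟨ solve 2 (λ e M → e :* M :+ (e :* M :+ e :* M) := con (ofℤ (+ 3)) :* M :* e) refl e M ⟩
  ofℤ (+ 3) * M * e                                ∎
  where
  open ≤-Reasoning
  ∣d1∣ = ∣ d1 ∣
  ∣d2∣ = ∣ d2 ∣
  ∣d3∣ = ∣ d3 ∣
  M1 = maxAbs v1
  M2 = maxAbs v2
  M3 = maxAbs v3
  e = ∣d1∣ ⊔ ∣d2∣ ⊔ ∣d3∣
  M = M1 ⊔ M2 ⊔ M3
  term : ∀ {d v} → ∣ d ∣ ≤ e → maxAbs v ≤ M → ∣ d * π v ∣ ≤ e * M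
  term {v = v} ∣d∣≤e maxAbs≤M = ∣p*q∣≤r*s ∣d∣≤e (≤-trans (∣π∣≤maxAbs v) maxAbs≤M)

normH-·H : ∀ a b c x → normH a b (c ·H x) ≡ (c * c) * normH a b x
normH-·H a b c (quat x0 x1 x2 x3) = solve 7 (λ a b c x0 x1 x2 x3 →
  (c :* x0) :* (c :* x0) :+ a :* ((c :* x1) :* (c :* x1)) :+ b :* ((c :* x2) :* (c :* x2))
    :+ (a :* b) :* ((c :* x3) :* (c :* x3))
  := (c :* c) :* (x0 :* x0 :+ a :* (x1 :* x1) :+ b :* (x2 :* x2) :+ (a :* b) :* (x3 :* x3)))
  refl a b c x0 x1 x2 x3

normH-·H-<1 : ∀ a b c P x → .{{Positive c}} → c * P ≡ 1ℚ → normH a b x < P * P → normH a b (c ·H x) < 1ℚ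
normH-·H-<1 a b c P x cP≡1 Nx<P*P = begin-strict
  normH a b (c ·H x)     ≡⟨ normH-·H a b c x ⟩
  (c * c) * normH a b x  <⟨ *-monoʳ-<-pos (c * c) {{pos*pos⇒pos c c}} Nx<P*P ⟩
  (c * c) * (P * P)      ≡⟨ solve 2 (λ c P → (c :* c) :* (P :* P) := (c :* P) :* (c :* P)) refl c P ⟩
  (c * P) * (c * P)      ≡⟨ cong₂ _*_ cP≡1 cP≡1 ⟩
  1ℚ * 1ℚ                ≡⟨ *-identityˡ 1ℚ ⟩
  1ℚ                     ∎
  where open ≤-Reasoning

normH-mono : ∀ {a b s t} x → 0ℚ ≤ a → 0ℚ ≤ b →
  ∣ q0 x ∣ ≤ s → ∣ q1 x ∣ ≤ t → ∣ q2 x ∣ ≤ t → ∣ q3 x ∣ ≤ t →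
  normH a b x ≤ normH a b (quat s t t t)
normH-mono {a} {b} x 0≤a 0≤b ∣x0∣≤s ∣x1∣≤t ∣x2∣≤t ∣x3∣≤t =
  +-mono-≤ (+-mono-≤ (+-mono-≤ (∣p∣≤q⇒p*p≤q*q ∣x0∣≤s)
                               (*-monoˡ-≤-nonNeg a (∣p∣≤q⇒p*p≤q*q ∣x1∣≤t)))
                     (*-monoˡ-≤-nonNeg b (∣p∣≤q⇒p*p≤q*q ∣x2∣≤t)))
           (*-monoˡ-≤-nonNeg (a * b) (∣p∣≤q⇒p*p≤q*q ∣x3∣≤t))
  where
  instance
    a≥0 : NonNegative a
    a≥0 = nonNegative 0≤a
    b≥0 : NonNegative b
    b≥0 = nonNegative 0≤b
    ab≥0 : NonNegative (a * b)
    ab≥0 = nonNeg*nonNeg⇒nonNeg a b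

normH-zcomb≤ : ∀ {a b s} d0 d1 d2 d3 v1 v2 v3 → 0ℚ ≤ a → 0ℚ ≤ b → ∣ ofℤ d0 ∣ ≤ s →
  let t = ofℤ (+ 3) * maxCoeff v1 v2 v3 * (∣ ofℤ d1 ∣ ⊔ ∣ ofℤ d2 ∣ ⊔ ∣ ofℤ d3 ∣) in
  normH a b (zcomb d0 d1 d2 d3 v1 v2 v3) ≤ normH a b (quat (s + t) t t t)
normH-zcomb≤ d0 d1 d2 d3 v1 v2 v3 0≤a 0≤b ∣d0∣≤s =
  normH-mono (zcomb d0 d1 d2 d3 v1 v2 v3) 0≤a 0≤b
    (≤-trans (∣p+q∣≤∣p∣+∣q∣ (ofℤ d0) _) (+-mono-≤ ∣d0∣≤s (∣Σdᵣπvᵣ∣≤t q0 ∣q0∣≤maxAbs)))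
    (∣0+Σdᵣπvᵣ∣≤t q1 ∣q1∣≤maxAbs) (∣0+Σdᵣπvᵣ∣≤t q2 ∣q2∣≤maxAbs) (∣0+Σdᵣπvᵣ∣≤t q3 ∣q3∣≤maxAbs)
  where
  Σdᵣπvᵣ : (Quat → ℚ) → ℚ
  Σdᵣπvᵣ π = ofℤ d1 * π v1 + (ofℤ d2 * π v2 + ofℤ d3 * π v3)
  t = ofℤ (+ 3) * maxCoeff v1 v2 v3 * (∣ ofℤ d1 ∣ ⊔ ∣ ofℤ d2 ∣ ⊔ ∣ ofℤ d3 ∣)
  ∣Σdᵣπvᵣ∣≤t : ∀ π → (∀ x → ∣ π x ∣ ≤ maxAbs x) → ∣ Σdᵣπvᵣ π ∣ ≤ t
  ∣Σdᵣπvᵣ∣≤t π ∣π∣≤maxAbs = ∣Σdᵣπvᵣ∣≤3*maxCoeff*max∣dᵣ∣ π ∣π∣≤maxAbs (ofℤ d1) (ofℤ d2) (ofℤ d3) v1 v2 v3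
  ∣0+Σdᵣπvᵣ∣≤t : ∀ π → (∀ x → ∣ π x ∣ ≤ maxAbs x) → ∣ 0ℚ + Σdᵣπvᵣ π ∣ ≤ t
  ∣0+Σdᵣπvᵣ∣≤t π ∣π∣≤maxAbs = subst (λ x → ∣ x ∣ ≤ t) (sym (+-identityˡ (Σdᵣπvᵣ π))) (∣Σdᵣπvᵣ∣≤t π ∣π∣≤maxAbs)

normH-box<P*P : ∀ a b M e P →
  let u = e * (ofℤ (+ 2) * M)
      t = ofℤ (+ 3) * M * e
      D = 1ℚ + ofℤ (+ 3) * ((1ℚ + a) * (1ℚ + b)) in
  u * u * D < (P - u) * (P - u) →
  normH a b (quat (½ * P + t) t t t) < P * P
normH-box<P*P a b M e P u²D<[P-u]² = begin-strict
  N                ≡⟨ +-identityʳ N ⟨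
  N + 0ℚ           <⟨ +-monoʳ-< N 0<¾gap ⟩
  N + ¾ * gap      ≡⟨ completing-square ⟩
  P * P            ∎
  where
  open ≤-Reasoning
  u = e * (ofℤ (+ 2) * M)
  t = ofℤ (+ 3) * M * e
  D = 1ℚ + ofℤ (+ 3) * ((1ℚ + a) * (1ℚ + b))
  N = normH a b (quat (½ * P + t) t t t)
  ¾ = + 3 / 4
  gap = (P - u) * (P - u) - u * u * D
  0<¾gap : 0ℚ < ¾ * gap
  0<¾gap = positive⁻¹ (¾ * gap) {{pos*pos⇒pos ¾ gap {{positive (p<q⇒0<q-p u²D<[P-u]²)}}}}
  -- With t = 3Me and u = 2Me the terms linear in P cancel, and (1 + a)(1 + b)t² cancels against ¾u²(D − 1).
  completing-square : N + ¾ * gap ≡ P * P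
  completing-square = solve 5 (λ a b M e P →
    let T = con (ofℤ (+ 3)) :* M :* e
        U = e :* (con (ofℤ (+ 2)) :* M)
        D = con 1ℚ :+ con (ofℤ (+ 3)) :* ((con 1ℚ :+ a) :* (con 1ℚ :+ b))
    in (con ½ :* P :+ T) :* (con ½ :* P :+ T) :+ a :* (T :* T) :+ b :* (T :* T) :+ (a :* b) :* (T :* T)
       :+ con ¾ :* ((P :- U) :* (P :- U) :- U :* U :* D)
    := P :* P) refl a b M e P

-- Only the lower bound 2M(1 + √(1 + 3d)) ≤ Q is used.
lemma4p4 : (a b : ℚ) → 0ℚ < a → 0ℚ < b → IsDivisionAlgebra a b →
    (v1 v2 v3 : Quat) → IsOrderWithBasis a b v1 v2 v3 →
    (Q : ℤ) → IsQ a b (maxCoeff v1 v2 v3) Q →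
    (p : ℕ) → (pp : Prime p) →
    (d0 d1 d2 d3 : ℤ) →
    ∣ ofℤ d0 ∣ ≤ (+ p) / 2 → ∣ ofℤ d1 ∣ ≤ (+ p) / 2 →
    ∣ ofℤ d2 ∣ ≤ (+ p) / 2 → ∣ ofℤ d3 ∣ ≤ (+ p) / 2 →
    ∣ ofℤ d1 ∣ * ofℤ Q < (+ p) / 1 → ∣ ofℤ d2 ∣ * ofℤ Q < (+ p) / 1 →
    ∣ ofℤ d3 ∣ * ofℤ Q < (+ p) / 1 →
    normH a b (invPrime p pp ·H zcomb d0 d1 d2 d3 v1 v2 v3) < 1ℚ
lemma4p4 _ _ _ _ _ _ _ _ _ _ _ ℕ.zero pp = ⊥-elim (ℕ.NonZero.nonZero (prime⇒nonZero pp))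
lemma4p4 a b 0<a 0<b _ v1 v2 v3 _ Q (Q≥2M[1+√D] , _) (suc m) _
  d0 d1 d2 d3 ∣d0∣≤p/2 _ _ _ ∣d1∣Q<p ∣d2∣Q<p ∣d3∣Q<p =
  normH-·H-<1 a b (+ 1 / suc m) P δ {{normalize-pos 1 (suc m)}} (1/n*n≡1 m) (begin-strict
    normH a b δ                                 ≤⟨ normH-zcomb≤ d0 d1 d2 d3 v1 v2 v3 (<⇒≤ 0<a) (<⇒≤ 0<b) ∣d0∣≤½P ⟩
    normH a b (quat (½ * P + t) t t t)          <⟨ normH-box<P*P a b M e P 2Me[1+√D]<P ⟩
    P * P                                       ∎)
  where
  open ≤-Reasoning
  P = + suc m / 1
  δ = zcomb d0 d1 d2 d3 v1 v2 v3
  M = maxCoeff v1 v2 v3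
  ∣d1∣ = ∣ ofℤ d1 ∣
  ∣d2∣ = ∣ ofℤ d2 ∣
  ∣d3∣ = ∣ ofℤ d3 ∣
  e = ∣d1∣ ⊔ ∣d2∣ ⊔ ∣d3∣
  t = ofℤ (+ 3) * M * e
  2M = ofℤ (+ 2) * M
  u = e * 2M
  D = 1ℚ + ofℤ (+ 3) * ((1ℚ + a) * (1ℚ + b))
  0≤e : 0ℚ ≤ e
  0≤e = ≤-trans (0≤∣p∣ (ofℤ d1)) (p≤p⊔q⊔r ∣d1∣ ∣d2∣ ∣d3∣)
  ∣d0∣≤½P : ∣ ofℤ d0 ∣ ≤ ½ * P
  ∣d0∣≤½P = subst (∣ ofℤ d0 ∣ ≤_) (n/2≡½*n (suc m)) ∣d0∣≤p/2
  eQ<P : e * ofℤ Q < P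
  eQ<P = ⊔-preserves (λ x → x * ofℤ Q < P) (∣d1∣ ⊔ ∣d2∣) ∣d3∣
           (⊔-preserves (λ x → x * ofℤ Q < P) ∣d1∣ ∣d2∣ ∣d1∣Q<p ∣d2∣Q<p) ∣d3∣Q<p
  2Me[1+√D]<P : u * u * D < (P - u) * (P - u)
  2Me[1+√D]<P = SqrtLe-<⇒ {r = u} {c = u} {D = D}
    (SqrtLe-scale {r = 2M} {c = 2M} {D = D} {q = ofℤ Q} e 0≤e Q≥2M[1+√D]) eQ<P
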